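{- Let $k\ge 2$ be an integer and define $n_0(k)=2k+1$ for $k\ge 3$ and $n_0(2)=6$. Then for every $n\ge n_0(k)$, $\chi_D(LG_1(k,n))=3$.
   Context: For positive integers $k,n$ with $2k<n$, $LG_1(k,n)$ is the bipartite graph with parts $L=\binom{[n]}{k-1}$ (the $(k-1)$-subsets of $[n]=\{1,\dots,n\}$) and $R=\binom{[n]}{k}$ (the $k$-subsets of $[n]$), where $u\in L$ and $v\in R$ are adjacent iff $u\subset v$. The distinguishing chromatic number $\chi_D(G)$ is the least number of colors in a proper vertex coloring of $G$ such that the only automorphism of $G$ mapping every color class onto itself is the identity. -}

module Defs where

open import Data.Nat using (ℕ; zero; suc; _+_; _*_; _∸_; _<_)
open import Data.Fin using (Fin)
open import Data.Fin.Subset using (Subset; _⊆_; ∣_∣)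
open import Data.Sum using (_⊎_; inj₁; inj₂)
open import Data.Product using (Σ; _×_; ∃-syntax)
open import Data.Empty using (⊥)
open import Relation.Nullary using (¬_)
open import Relation.Binary.PropositionalEquality using (_≡_; _≢_)
open import Function.Bundles using (_↔_; Inverse)

record Graph : Set₁ where
  field
    V   : Set
    Adj : V → V → Set
open Graph public

record Automorphism (G : Graph) : Set where
  field
    perm     : V G ↔ V G
    preserve : ∀ u v → (Adj G u v → Adj G (Inverse.to perm u) (Inverse.to perm v))
                     × (Adj G (Inverse.to perm u) (Inverse.to perm v) → Adj G u v)
open Automorphism public

Colouring : Graph → ℕ → Set
Colouring G c = V G → Fin c

Proper : (G : Graph) {c : ℕ} → Colouring G c → Set
Proper G col = ∀ u v → Adj G u v → col u ≢ col v

PreservesClasses : (G : Graph) {c : ℕ} → Colouring G c → Automorphism G → Set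
PreservesClasses G col σ = ∀ v → col (Inverse.to (perm σ) v) ≡ col v

Distinguishing : (G : Graph) {c : ℕ} → Colouring G c → Set
Distinguishing G col = ∀ (σ : Automorphism G) → PreservesClasses G col σ →
                       ∀ v → Inverse.to (perm σ) v ≡ v

HasDistColouring : Graph → ℕ → Set
HasDistColouring G c = ∃[ col ] (Proper G {c} col × Distinguishing G col)

DistChromaticNumberIs : Graph → ℕ → Set
DistChromaticNumberIs G m = HasDistColouring G m × (∀ c → c < m → ¬ HasDistColouring G c)

LG1-V : ℕ → ℕ → Set
LG1-V k n = Σ (Subset n) (λ s → ∣ s ∣ ≡ k ∸ 1) ⊎ Σ (Subset n) (λ s → ∣ s ∣ ≡ k)

LG1-Adj : (k n : ℕ) → LG1-V k n → LG1-V k n → Set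
LG1-Adj k n (inj₁ (u Data.Product., _)) (inj₂ (v Data.Product., _)) = u ⊆ v
LG1-Adj k n (inj₂ (v Data.Product., _)) (inj₁ (u Data.Product., _)) = u ⊆ v
LG1-Adj k n (inj₁ _) (inj₁ _) = ⊥
LG1-Adj k n (inj₂ _) (inj₂ _) = ⊥

LG1 : ℕ → ℕ → Graph
LG1 k n = record { V = LG1-V k n ; Adj = LG1-Adj k n }

-- n₀(2) = 6, n₀(k) = 2k+1 for k ≥ 3 (other values irrelevant).
n₀ : ℕ → ℕ
n₀ 2 = 6
n₀ k = 2 * k + 1

module Submission where

-- Colour every (k-1)-set with 0 and split the k-sets between colours 1 and 2 according to a
-- family F.  An automorphism fixing the colour classes keeps both sides, so it is a bijection of
-- the (k-1)-sets and of the k-sets preserving inclusion both ways.  Such a pair is induced by a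
-- permutation of [n]: descending one level at a time, an m-set D is the intersection u ∩ u' of two
-- (m+1)-sets below a common (m+2)-set z, and the (m+1)-sets containing D can be recognised from
-- inclusions alone (they are u, u', and the sets sharing an upper neighbour with both u and u' but
-- not lying below z).  Hence the colouring is distinguishing once F is rigid, i.e. fixed by no
-- permutation but the identity.  Rigid families are grown from an asymmetric graph on 6 points by
-- adding one point at a time, either keeping the set size (extend) or raising it by one (cone);
-- this is where the threshold n₀ k comes from.  Conversely, transposing two points fixes every
-- proper colouring with at most two colours, because a set and its image have a common neighbour.

open import Defs
open import Data.Bool using (Bool; true; false; not; _∧_; _∨_; if_then_else_)
import Data.Bool as Bool
open import Data.Bool.Properties using (not-injective)
open import Data.Empty using (⊥-elim)
open import Data.Fin as Fin using (Fin; zero; suc)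
import Data.Fin.Properties as Finₚ
open import Data.Fin.Subset renaming (⊥ to ∅)
open import Data.Fin.Subset.Properties
open import Data.List using (List; []; _∷_; allFin)
open import Data.List.Membership.Propositional.Properties using (∈-allFin)
open import Data.List.Relation.Unary.All as All using (All; []; _∷_)
open import Data.Nat using (ℕ; zero; suc; _+_; _∸_; _≤_; _<_; z≤n; s≤s; z<s; _≤?_)
import Data.Nat as ℕ
open import Data.Nat.Properties
open import Data.Product using (Σ; _×_; _,_; proj₁; proj₂; ∃; map₂)
open import Data.Sum using (_⊎_; inj₁; inj₂; [_,_])
open import Data.Sum.Properties using (inj₁-injective; inj₂-injective)
open import Data.Vec using ([]; _∷_; here; there; tail)
open import Data.Vec.Properties using (≡-dec)
open import Function using (_∘_; id)
open import Function.Bundles using (Inverse; mk↔ₛ′)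
open import Function.Definitions using (Injective; StrictlySurjective)
open import Relation.Binary.PropositionalEquality hiding ([_])
open import Relation.Nullary using (¬_; Dec; yes; no; contradiction)
open import Relation.Nullary.Decidable using (_→-dec_; _×-dec_; ¬?; map′; from-yes)

private variable n m : ℕ

-- Sets of a given size

Choose : ℕ → ℕ → Set
Choose n m = Σ (Subset n) λ s → ∣ s ∣ ≡ m

Choose-≡ : {u v : Choose n m} → proj₁ u ≡ proj₁ v → u ≡ v
Choose-≡ {u = s , p} {v = .s , q} refl = cong (s ,_) (≡-irrelevant p q)

⊆∧∣≡∣⇒≡ : {p q : Subset n} → p ⊆ q → ∣ p ∣ ≡ ∣ q ∣ → p ≡ q
⊆∧∣≡∣⇒≡ {p = []} {[]} _ _ = refl
⊆∧∣≡∣⇒≡ {p = true ∷ p} {true ∷ q} p⊆q e = cong (true ∷_) (⊆∧∣≡∣⇒≡ (drop-∷-⊆ p⊆q) (suc-injective e))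
⊆∧∣≡∣⇒≡ {p = false ∷ p} {false ∷ q} p⊆q e = cong (false ∷_) (⊆∧∣≡∣⇒≡ (drop-∷-⊆ p⊆q) e)
⊆∧∣≡∣⇒≡ {p = true ∷ p} {false ∷ q} p⊆q _ with p⊆q here
... | ()
⊆∧∣≡∣⇒≡ {p = false ∷ p} {true ∷ q} p⊆q e =
  contradiction (subst (_≤ ∣ q ∣) e (p⊆q⇒∣p∣≤∣q∣ (drop-∷-⊆ p⊆q))) 1+n≰n

∣p∪q∣+∣p∩q∣≡∣p∣+∣q∣ : (p q : Subset n) → ∣ p ∪ q ∣ + ∣ p ∩ q ∣ ≡ ∣ p ∣ + ∣ q ∣
∣p∪q∣+∣p∩q∣≡∣p∣+∣q∣ [] [] = refl
∣p∪q∣+∣p∩q∣≡∣p∣+∣q∣ (true ∷ p) (true ∷ q) =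
  cong suc (trans (+-suc _ _) (trans (cong suc (∣p∪q∣+∣p∩q∣≡∣p∣+∣q∣ p q)) (sym (+-suc _ _))))
∣p∪q∣+∣p∩q∣≡∣p∣+∣q∣ (true ∷ p) (false ∷ q) = cong suc (∣p∪q∣+∣p∩q∣≡∣p∣+∣q∣ p q)
∣p∪q∣+∣p∩q∣≡∣p∣+∣q∣ (false ∷ p) (true ∷ q) = trans (cong suc (∣p∪q∣+∣p∩q∣≡∣p∣+∣q∣ p q)) (sym (+-suc _ _))
∣p∪q∣+∣p∩q∣≡∣p∣+∣q∣ (false ∷ p) (false ∷ q) = ∣p∪q∣+∣p∩q∣≡∣p∣+∣q∣ p q

x∉p⇒∣p∪⁅x⁆∣≡1+∣p∣ : {p : Subset n} {x : Fin n} → x ∉ p → ∣ p ∪ ⁅ x ⁆ ∣ ≡ suc ∣ p ∣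
x∉p⇒∣p∪⁅x⁆∣≡1+∣p∣ {p = true ∷ p} {zero} x∉p = contradiction here x∉p
x∉p⇒∣p∪⁅x⁆∣≡1+∣p∣ {p = false ∷ p} {zero} _ = cong (suc ∘ ∣_∣) (∪-identityʳ p)
x∉p⇒∣p∪⁅x⁆∣≡1+∣p∣ {p = true ∷ p} {suc x} x∉p = cong suc (x∉p⇒∣p∪⁅x⁆∣≡1+∣p∣ (x∉p ∘ there))
x∉p⇒∣p∪⁅x⁆∣≡1+∣p∣ {p = false ∷ p} {suc x} x∉p = x∉p⇒∣p∪⁅x⁆∣≡1+∣p∣ (x∉p ∘ there)

0<∣p∣⇒Nonempty : (p : Subset n) → 0 < ∣ p ∣ → Nonempty p
0<∣p∣⇒Nonempty (true ∷ p) _ = zero , here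
0<∣p∣⇒Nonempty (false ∷ p) 0<∣p∣ with 0<∣p∣⇒Nonempty p 0<∣p∣
... | x , x∈p = suc x , there x∈p

∣p∣<n⇒∃∉ : (p : Subset n) → ∣ p ∣ < n → ∃ λ x → x ∉ p
∣p∣<n⇒∃∉ (false ∷ p) _ = zero , λ ()
∣p∣<n⇒∃∉ (true ∷ p) (s≤s ∣p∣<n) with ∣p∣<n⇒∃∉ p ∣p∣<n
... | x , x∉p = suc x , x∉p ∘ drop-there

⊈⇒∃∈∉ : {p q : Subset n} → ¬ p ⊆ q → ∃ λ x → x ∈ p × x ∉ q
⊈⇒∃∈∉ {p = []} {[]} p⊈q = ⊥-elim (p⊈q λ ())
⊈⇒∃∈∉ {p = true ∷ p} {false ∷ q} _ = zero , here , λ ()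
⊈⇒∃∈∉ {p = false ∷ p} {_ ∷ q} p⊈q = shift (⊈⇒∃∈∉ (p⊈q ∘ out⊆))
  where shift : ∀ {s t} → (∃ λ x → x ∈ p × x ∉ q) → ∃ λ x → x ∈ s ∷ p × x ∉ t ∷ q
        shift (x , x∈p , x∉q) = suc x , there x∈p , x∉q ∘ drop-there
⊈⇒∃∈∉ {p = true ∷ p} {true ∷ q} p⊈q with ⊈⇒∃∈∉ (p⊈q ∘ in⊆in)
... | x , x∈p , x∉q = suc x , there x∈p , x∉q ∘ drop-there

∪-least : {p q r : Subset n} → p ⊆ r → q ⊆ r → p ∪ q ⊆ r
∪-least {p = p} {q} p⊆r q⊆r x∈p∪q = [ p⊆r , q⊆r ] (x∈p∪q⁻ p q x∈p∪q)

∩-greatest : {p q r : Subset n} → r ⊆ p → r ⊆ q → r ⊆ p ∩ q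
∩-greatest r⊆p r⊆q x∈r = x∈p∩q⁺ (r⊆p x∈r , r⊆q x∈r)

x∈p⇒⁅x⁆⊆p : {p : Subset n} {x : Fin n} → x ∈ p → ⁅ x ⁆ ⊆ p
x∈p⇒⁅x⁆⊆p {p = p} x∈p y∈⁅x⁆ = subst (_∈ p) (sym (x∈⁅y⁆⇒x≡y _ y∈⁅x⁆)) x∈p

∣p∣≡1∧x∈p⇒p≡⁅x⁆ : {p : Subset n} {x : Fin n} → ∣ p ∣ ≡ 1 → x ∈ p → p ≡ ⁅ x ⁆
∣p∣≡1∧x∈p⇒p≡⁅x⁆ {x = x} ∣p∣≡1 x∈p = sym (⊆∧∣≡∣⇒≡ (x∈p⇒⁅x⁆⊆p x∈p) (trans (∣⁅x⁆∣≡1 x) (sym ∣p∣≡1)))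

between : (p q : Subset n) → p ⊆ q → ∣ p ∣ ≤ m → m ≤ ∣ q ∣ → ∃ λ r → p ⊆ r × r ⊆ q × ∣ r ∣ ≡ m
between [] [] _ _ z≤n = [] , (λ ()) , (λ ()) , refl
between (true ∷ p) (false ∷ q) p⊆q _ _ with p⊆q here
... | ()
between (true ∷ p) (true ∷ q) p⊆q (s≤s lo) (s≤s hi) with between p q (drop-∷-⊆ p⊆q) lo hi
... | r , p⊆r , r⊆q , ∣r∣≡m = true ∷ r , in⊆in p⊆r , in⊆in r⊆q , cong suc ∣r∣≡m
between (false ∷ p) (false ∷ q) p⊆q lo hi with between p q (drop-∷-⊆ p⊆q) lo hi
... | r , p⊆r , r⊆q , ∣r∣≡m = false ∷ r , out⊆ p⊆r , out⊆ r⊆q , ∣r∣≡m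
between {m = m} (false ∷ p) (true ∷ q) p⊆q lo hi with m ≤? ∣ q ∣
... | yes m≤∣q∣ with between p q (drop-∷-⊆ p⊆q) lo m≤∣q∣
...   | r , p⊆r , r⊆q , ∣r∣≡m = false ∷ r , out⊆ p⊆r , out⊆ r⊆q , ∣r∣≡m
between {m = m} (false ∷ p) (true ∷ q) p⊆q lo hi | no m≰∣q∣ =
  true ∷ q , out⊆ (drop-∷-⊆ p⊆q) , ⊆-refl , ≤-antisym (≰⇒> m≰∣q∣) hi

some-set : m ≤ n → Choose n m
some-set {m} {n} m≤n with between ∅ ⊤ ⊥⊆ (subst (_≤ m) (sym (∣⊥∣≡0 n)) z≤n) (subst (m ≤_) (sym (∣⊤∣≡n n)) m≤n)
... | s , _ , _ , ∣s∣≡m = s , ∣s∣≡m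

set-through : (y : Fin n) → 1 ≤ m → m ≤ n → Σ (Choose n m) λ s → y ∈ proj₁ s
set-through {n} {m} y 1≤m m≤n
  with between ⁅ y ⁆ ⊤ ⊆⊤ (subst (_≤ m) (sym (∣⁅x⁆∣≡1 y)) 1≤m) (subst (m ≤_) (sym (∣⊤∣≡n n)) m≤n)
... | s , ⁅y⁆⊆s , _ , ∣s∣≡m = (s , ∣s∣≡m) , ⁅y⁆⊆s (x∈⁅x⁆ y)

set-avoiding : (y : Fin n) → m < n → Σ (Choose n m) λ s → y ∉ proj₁ s
set-avoiding {suc n} {m} y (s≤s m≤n) with between ∅ (∁ ⁅ y ⁆) ⊥⊆ (subst (_≤ m) (sym (∣⊥∣≡0 (suc n))) z≤n)
                                  (subst (m ≤_) (sym (trans (∣∁p∣≡n∸∣p∣ ⁅ y ⁆) (cong (suc n ∸_) (∣⁅x⁆∣≡1 y)))) m≤n)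
... | s , _ , s⊆∁⁅y⁆ , ∣s∣≡m = (s , ∣s∣≡m) , λ y∈s → x∈p⇒x∉∁p (x∈⁅x⁆ y) (s⊆∁⁅y⁆ y∈s)

set-through-avoiding : {x y : Fin (suc n)} → x ≢ y → 1 ≤ m → m ≤ n →
                       Σ (Choose (suc n) m) λ s → x ∈ proj₁ s × y ∉ proj₁ s
set-through-avoiding {n} {m} {x} {y} x≢y 1≤m m≤n
  with between ⁅ x ⁆ (∁ ⁅ y ⁆) ⁅x⁆⊆∁⁅y⁆ (subst (_≤ m) (sym (∣⁅x⁆∣≡1 x)) 1≤m)
               (subst (m ≤_) (sym (trans (∣∁p∣≡n∸∣p∣ ⁅ y ⁆) (cong (suc n ∸_) (∣⁅x⁆∣≡1 y)))) m≤n)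
  where
  ⁅x⁆⊆∁⁅y⁆ : ⁅ x ⁆ ⊆ ∁ ⁅ y ⁆
  ⁅x⁆⊆∁⁅y⁆ z∈⁅x⁆ = x∉p⇒x∈∁p (subst (_∉ ⁅ y ⁆) (sym (x∈⁅y⁆⇒x≡y x z∈⁅x⁆)) (x≢y⇒x∉⁅y⁆ x≢y))
... | s , ⁅x⁆⊆s , s⊆∁⁅y⁆ , ∣s∣≡m = (s , ∣s∣≡m) , ⁅x⁆⊆s (x∈⁅x⁆ x) , λ y∈s → x∈p⇒x∉∁p (x∈⁅x⁆ y) (s⊆∁⁅y⁆ y∈s)

pair : {a b : Fin n} → a ≢ b → Choose n 2
pair {a = a} {b} a≢b = ⁅ a ⁆ ∪ ⁅ b ⁆ , trans (x∉p⇒∣p∪⁅x⁆∣≡1+∣p∣ (x≢y⇒x∉⁅y⁆ (a≢b ∘ sym))) (cong suc (∣⁅x⁆∣≡1 a))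

two-outside : (D : Subset n) → suc (suc ∣ D ∣) ≤ n → ∃ λ a → ∃ λ b → a ∉ D × b ∉ D × a ≢ b
two-outside D 2+∣D∣≤n with ∣p∣<n⇒∃∉ D (≤-trans (n≤1+n _) 2+∣D∣≤n)
... | a , a∉D with ∣p∣<n⇒∃∉ (D ∪ ⁅ a ⁆) (subst (_< _) (sym (x∉p⇒∣p∪⁅x⁆∣≡1+∣p∣ a∉D)) 2+∣D∣≤n)
... | b , b∉D+a = a , b , a∉D , b∉D+a ∘ x∈p∪q⁺ ∘ inj₁ , λ a≡b → b∉D+a (x∈p∪q⁺ (inj₂ (subst (_∈ ⁅ a ⁆) a≡b (x∈⁅x⁆ a))))

⊆-all-covers⇒⊆ : {u u' : Subset n} → ∣ u ∣ ≡ m → suc (suc m) ≤ n →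
                 (∀ (z : Choose n (suc m)) → u ⊆ proj₁ z → u' ⊆ proj₁ z) → u' ⊆ u
⊆-all-covers⇒⊆ {n} {m} {u} ∣u∣≡m 2+m≤n u'⊆covers {y} y∈u' with y ∈? u
... | yes y∈u = y∈u
... | no y∉u with ∣p∣<n⇒∃∉ (u ∪ ⁅ y ⁆) (subst (_< n) (sym (trans (x∉p⇒∣p∪⁅x⁆∣≡1+∣p∣ y∉u) (cong suc ∣u∣≡m))) 2+m≤n)
...   | x , x∉u+y =
  [ id , (λ y∈⁅x⁆ → ⊥-elim (x∉u+y (x∈p∪q⁺ (inj₂ (subst (_∈ ⁅ y ⁆) (x∈⁅y⁆⇒x≡y x y∈⁅x⁆) (x∈⁅x⁆ y)))))) ]
  (x∈p∪q⁻ u ⁅ x ⁆ (u'⊆covers (u ∪ ⁅ x ⁆ , trans (x∉p⇒∣p∪⁅x⁆∣≡1+∣p∣ (x∉u+y ∘ x∈p∪q⁺ ∘ inj₁)) (cong suc ∣u∣≡m))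
                             (p⊆p∪q ⁅ x ⁆) y∈u'))

module SameLevel (w x : Subset n) (∣w∣≡1+m : ∣ w ∣ ≡ suc m) (∣x∣≡1+m : ∣ x ∣ ≡ suc m) where

  ∣w∪x∣+∣w∩x∣≡2+2m : ∣ w ∪ x ∣ + ∣ w ∩ x ∣ ≡ suc m + suc m
  ∣w∪x∣+∣w∩x∣≡2+2m = trans (∣p∪q∣+∣p∩q∣≡∣p∣+∣q∣ w x) (cong₂ _+_ ∣w∣≡1+m ∣x∣≡1+m)

  ∣w∪x∣≤2+m⇒m≤∣w∩x∣ : ∣ w ∪ x ∣ ≤ suc (suc m) → m ≤ ∣ w ∩ x ∣
  ∣w∪x∣≤2+m⇒m≤∣w∩x∣ ∣w∪x∣≤2+m = +-cancelˡ-≤ m m _ (≤-pred (≤-pred (begin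
    suc (suc (m + m))             ≡⟨ cong suc (+-suc m m) ⟨
    suc m + suc m                 ≡⟨ ∣w∪x∣+∣w∩x∣≡2+2m ⟨
    ∣ w ∪ x ∣ + ∣ w ∩ x ∣         ≤⟨ +-monoˡ-≤ _ ∣w∪x∣≤2+m ⟩
    suc (suc (m + ∣ w ∩ x ∣))     ∎)))
    where open ≤-Reasoning

  ∣w∩x∣≡m⇒∣w∪x∣≡2+m : ∣ w ∩ x ∣ ≡ m → ∣ w ∪ x ∣ ≡ suc (suc m)
  ∣w∩x∣≡m⇒∣w∪x∣≡2+m ∣w∩x∣≡m = +-cancelʳ-≡ m _ _ (begin
    ∣ w ∪ x ∣ + m             ≡⟨ cong (∣ w ∪ x ∣ +_) ∣w∩x∣≡m ⟨
    ∣ w ∪ x ∣ + ∣ w ∩ x ∣     ≡⟨ ∣w∪x∣+∣w∩x∣≡2+2m ⟩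
    suc m + suc m             ≡⟨ cong suc (+-suc m m) ⟩
    suc (suc m) + m           ∎)
    where open ≡-Reasoning

  w≢x⇒∣w∩x∣≤m : w ≢ x → ∣ w ∩ x ∣ ≤ m
  w≢x⇒∣w∩x∣≤m w≢x = ≤-pred (≤∧≢⇒< (subst (∣ w ∩ x ∣ ≤_) ∣w∣≡1+m (∣p∩q∣≤∣p∣ w x)) ∣w∩x∣≢1+m)
    where
    ∣w∩x∣≢1+m : ∣ w ∩ x ∣ ≢ suc m
    ∣w∩x∣≢1+m e = w≢x (trans (sym (⊆∧∣≡∣⇒≡ (p∩q⊆p w x) (trans e (sym ∣w∣≡1+m))))
                            (⊆∧∣≡∣⇒≡ (p∩q⊆q w x) (trans e (sym ∣x∣≡1+m))))

-- Inclusion-preserving maps between two levels come from permutations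

CommonCover : ℕ → Subset n → Subset n → Set
CommonCover {n} m w x = Σ (Choose n (suc (suc m))) λ z → w ⊆ proj₁ z × x ⊆ proj₁ z

-- The two lemmas of Siblings describe the (m+1)-sets containing u ∩ u' by inclusions alone, which
-- is what lets an inclusion-preserving map descend a level.
module Siblings {z u u' : Subset n} (∣z∣≡2+m : ∣ z ∣ ≡ suc (suc m)) (∣u∣≡1+m : ∣ u ∣ ≡ suc m)
                (∣u'∣≡1+m : ∣ u' ∣ ≡ suc m) (u⊆z : u ⊆ z) (u'⊆z : u' ⊆ z) (u≢u' : u ≢ u') where

  open SameLevel u u' ∣u∣≡1+m ∣u'∣≡1+m

  ∣u∩u'∣≡m : ∣ u ∩ u' ∣ ≡ m
  ∣u∩u'∣≡m = ≤-antisym (w≢x⇒∣w∩x∣≤m u≢u')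
    (∣w∪x∣≤2+m⇒m≤∣w∩x∣ (subst (∣ u ∪ u' ∣ ≤_) ∣z∣≡2+m (p⊆q⇒∣p∣≤∣q∣ (∪-least u⊆z u'⊆z))))

  z⊆u∪u' : z ⊆ u ∪ u'
  z⊆u∪u' = ⊆-reflexive (sym (⊆∧∣≡∣⇒≡ (∪-least u⊆z u'⊆z) (trans (∣w∩x∣≡m⇒∣w∪x∣≡2+m ∣u∩u'∣≡m) (sym ∣z∣≡2+m))))

  Outer : Subset n → Set
  Outer w = CommonCover m w u × CommonCover m w u' × ¬ w ⊆ z

  Outer⇒u∩u'⊆ : {w : Subset n} → ∣ w ∣ ≡ suc m → Outer w → u ∩ u' ⊆ w
  Outer⇒u∩u'⊆ {w} ∣w∣≡1+m ((Z₁ , w⊆Z₁ , u⊆Z₁) , (Z₂ , w⊆Z₂ , u'⊆Z₂) , w⊈z) {d} d∈u∩u' with d ∈? w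
  ... | yes d∈w = d∈w
  ... | no d∉w = contradiction ∣A∪B∣+∣A∩B∣<2m (≤⇒≯ 2m≤∣A∪B∣+∣A∩B∣)
    where
    A B : Subset n
    A = w ∩ u
    B = w ∩ u'
    c : Fin n
    c = proj₁ (⊈⇒∃∈∉ w⊈z)
    c∈w : c ∈ w
    c∈w = proj₁ (proj₂ (⊈⇒∃∈∉ w⊈z))
    c∉z : c ∉ z
    c∉z = proj₂ (proj₂ (⊈⇒∃∈∉ w⊈z))
    cover⇒m≤∣∩∣ : {x : Subset n} → ∣ x ∣ ≡ suc m → (Z : Choose n (suc (suc m))) →
                  w ⊆ proj₁ Z → x ⊆ proj₁ Z → m ≤ ∣ w ∩ x ∣
    cover⇒m≤∣∩∣ ∣x∣≡1+m (Z , ∣Z∣≡2+m) w⊆Z x⊆Z = SameLevel.∣w∪x∣≤2+m⇒m≤∣w∩x∣ w _ ∣w∣≡1+m ∣x∣≡1+m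
      (subst (_ ≤_) ∣Z∣≡2+m (p⊆q⇒∣p∣≤∣q∣ (∪-least w⊆Z x⊆Z)))
    ∣A∩B∣<m : ∣ A ∩ B ∣ < m
    ∣A∩B∣<m = subst (∣ A ∩ B ∣ <_) ∣u∩u'∣≡m (p⊂q⇒∣p∣<∣q∣
      ( (λ x∈A∩B → x∈p∩q⁺ (proj₂ (x∈p∩q⁻ w u (p∩q⊆p A B x∈A∩B)) , proj₂ (x∈p∩q⁻ w u' (p∩q⊆q A B x∈A∩B))))
      , d , d∈u∩u' , d∉w ∘ p∩q⊆p w u ∘ p∩q⊆p A B))
    ∣A∪B∣<1+m : ∣ A ∪ B ∣ < suc m
    ∣A∪B∣<1+m = subst (∣ A ∪ B ∣ <_) ∣w∣≡1+m (p⊂q⇒∣p∣<∣q∣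
      ( ∪-least (p∩q⊆p w u) (p∩q⊆p w u')
      , c , c∈w , λ c∈A∪B → c∉z ([ u⊆z ∘ p∩q⊆q w u , u'⊆z ∘ p∩q⊆q w u' ] (x∈p∪q⁻ A B c∈A∪B))))
    ∣A∪B∣+∣A∩B∣<2m : ∣ A ∪ B ∣ + ∣ A ∩ B ∣ < m + m
    ∣A∪B∣+∣A∩B∣<2m = +-mono-≤-< (≤-pred ∣A∪B∣<1+m) ∣A∩B∣<m
    2m≤∣A∪B∣+∣A∩B∣ : m + m ≤ ∣ A ∪ B ∣ + ∣ A ∩ B ∣
    2m≤∣A∪B∣+∣A∩B∣ = subst (m + m ≤_) (sym (∣p∪q∣+∣p∩q∣≡∣p∣+∣q∣ A B))
      (+-mono-≤ (cover⇒m≤∣∩∣ ∣u∣≡1+m Z₁ w⊆Z₁ u⊆Z₁) (cover⇒m≤∣∩∣ ∣u'∣≡1+m Z₂ w⊆Z₂ u'⊆Z₂))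

  u∩u'⊆⇒ : {w : Subset n} → ∣ w ∣ ≡ suc m → u ∩ u' ⊆ w → w ≡ u ⊎ w ≡ u' ⊎ Outer w
  u∩u'⊆⇒ {w} ∣w∣≡1+m u∩u'⊆w with ≡-dec Bool._≟_ w u | ≡-dec Bool._≟_ w u'
  ... | yes w≡u | _ = inj₁ w≡u
  ... | no _ | yes w≡u' = inj₂ (inj₁ w≡u')
  ... | no w≢u | no w≢u' = inj₂ (inj₂ (cover u ∣u∣≡1+m w≢u (p∩q⊆p u u') , cover u' ∣u'∣≡1+m w≢u' (p∩q⊆q u u') , w⊈z))
    where
    ∣w∩_∣≡m : {x : Subset n} → ∣ x ∣ ≡ suc m → w ≢ x → u ∩ u' ⊆ x → ∣ w ∩ x ∣ ≡ m
    ∣w∩_∣≡m {x} ∣x∣≡1+m w≢x u∩u'⊆x = ≤-antisym (SameLevel.w≢x⇒∣w∩x∣≤m w x ∣w∣≡1+m ∣x∣≡1+m w≢x)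
      (subst (_≤ ∣ w ∩ x ∣) ∣u∩u'∣≡m (p⊆q⇒∣p∣≤∣q∣ (∩-greatest u∩u'⊆w u∩u'⊆x)))
    cover : (x : Subset n) → ∣ x ∣ ≡ suc m → w ≢ x → u ∩ u' ⊆ x → CommonCover m w x
    cover x ∣x∣≡1+m w≢x u∩u'⊆x =
      (w ∪ x , SameLevel.∣w∩x∣≡m⇒∣w∪x∣≡2+m w x ∣w∣≡1+m ∣x∣≡1+m (∣w∩_∣≡m ∣x∣≡1+m w≢x u∩u'⊆x)) ,
      p⊆p∪q x , q⊆p∪q w x
    A B : Subset n
    A = w ∩ u
    B = w ∩ u'
    w⊈z : ¬ w ⊆ z
    w⊈z w⊆z = 1+n≰n (begin
      suc m + m              ≤⟨ +-mono-≤ 1+m≤∣A∪B∣ m≤∣A∩B∣ ⟩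
      ∣ A ∪ B ∣ + ∣ A ∩ B ∣  ≡⟨ ∣p∪q∣+∣p∩q∣≡∣p∣+∣q∣ A B ⟩
      ∣ A ∣ + ∣ B ∣          ≡⟨ cong₂ _+_ (∣w∩_∣≡m ∣u∣≡1+m w≢u (p∩q⊆p u u')) (∣w∩_∣≡m ∣u'∣≡1+m w≢u' (p∩q⊆q u u')) ⟩
      m + m                  ∎)
      where
      open ≤-Reasoning
      1+m≤∣A∪B∣ : suc m ≤ ∣ A ∪ B ∣
      1+m≤∣A∪B∣ = subst (_≤ ∣ A ∪ B ∣) ∣w∣≡1+m (p⊆q⇒∣p∣≤∣q∣ λ {x} x∈w →
        [ (λ x∈u → x∈p∪q⁺ (inj₁ (x∈p∩q⁺ (x∈w , x∈u)))) , (λ x∈u' → x∈p∪q⁺ (inj₂ (x∈p∩q⁺ (x∈w , x∈u')))) ]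
        (x∈p∪q⁻ u u' (z⊆u∪u' (w⊆z x∈w))))
      m≤∣A∩B∣ : m ≤ ∣ A ∩ B ∣
      m≤∣A∩B∣ = subst (_≤ ∣ A ∩ B ∣) ∣u∩u'∣≡m (p⊆q⇒∣p∣≤∣q∣ λ x∈u∩u' →
        x∈p∩q⁺ (x∈p∩q⁺ (u∩u'⊆w x∈u∩u' , p∩q⊆p u u' x∈u∩u') , x∈p∩q⁺ (u∩u'⊆w x∈u∩u' , p∩q⊆q u u' x∈u∩u')))

PreservesInclusion : (Choose n m → Choose n m) → (Choose n (suc m) → Choose n (suc m)) → Set
PreservesInclusion α β = ∀ u v → (proj₁ u ⊆ proj₁ v → proj₁ (α u) ⊆ proj₁ (β v))
                               × (proj₁ (α u) ⊆ proj₁ (β v) → proj₁ u ⊆ proj₁ v)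

InducedBy : (Fin n → Fin n) → (Choose n m → Choose n m) → Set
InducedBy p β = ∀ v i → (i ∈ proj₁ v → p i ∈ proj₁ (β v)) × (p i ∈ proj₁ (β v) → i ∈ proj₁ v)

module _ {α : Choose n m → Choose n m} {β : Choose n (suc m) → Choose n (suc m)} (α⊆β : PreservesInclusion α β) where

  preservesInclusion⇒injective : suc (suc m) ≤ n → Injective _≡_ _≡_ α
  preservesInclusion⇒injective 2+m≤n {x} {y} αx≡αy = Choose-≡ (⊆-antisym
    (⊆-all-covers⇒⊆ (proj₂ y) 2+m≤n λ z y⊆z →
      proj₂ (α⊆β x z) (subst (λ t → proj₁ t ⊆ proj₁ (β z)) (sym αx≡αy) (proj₁ (α⊆β y z) y⊆z)))
    (⊆-all-covers⇒⊆ (proj₂ x) 2+m≤n λ z x⊆z →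
      proj₂ (α⊆β y z) (subst (λ t → proj₁ t ⊆ proj₁ (β z)) αx≡αy (proj₁ (α⊆β x z) x⊆z))))

  preservesInclusion-identity : suc (suc m) ≤ n → (∀ v → β v ≡ v) → ∀ u → α u ≡ u
  preservesInclusion-identity 2+m≤n β≗id u = Choose-≡ (⊆∧∣≡∣⇒≡
    (⊆-all-covers⇒⊆ (proj₂ u) 2+m≤n λ z u⊆z → subst (λ t → proj₁ (α u) ⊆ proj₁ t) (β≗id z) (proj₁ (α⊆β u z) u⊆z))
    (trans (proj₂ (α u)) (sym (proj₂ u))))

identity-induces-identity : {p : Fin n → Fin n} {β : Choose n m → Choose n m} →
                            (∀ i → p i ≡ i) → InducedBy p β → ∀ v → β v ≡ v
identity-induces-identity {β = β} p≗id p↝β v = Choose-≡ (⊆-antisym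
  (λ {i} i∈βv → proj₂ (p↝β v i) (subst (_∈ proj₁ (β v)) (sym (p≗id i)) i∈βv))
  (λ {i} i∈v → subst (_∈ proj₁ (β v)) (p≗id i) (proj₁ (p↝β v i) i∈v)))

module Fork (D : Subset n) (∣D∣≡m : ∣ D ∣ ≡ m) (2+m≤n : suc (suc m) ≤ n) where

  private
    picked : ∃ λ a → ∃ λ b → a ∉ D × b ∉ D × a ≢ b
    picked = two-outside D (subst (λ k → suc (suc k) ≤ n) (sym ∣D∣≡m) 2+m≤n)
    a b : Fin n
    a = proj₁ picked
    b = proj₁ (proj₂ picked)
    a∉D : a ∉ D
    a∉D = proj₁ (proj₂ (proj₂ picked))
    b∉D : b ∉ D
    b∉D = proj₁ (proj₂ (proj₂ (proj₂ picked)))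
    a≢b : a ≢ b
    a≢b = proj₂ (proj₂ (proj₂ (proj₂ picked)))

  u u' z : Subset n
  u = D ∪ ⁅ a ⁆
  u' = D ∪ ⁅ b ⁆
  z = u ∪ ⁅ b ⁆

  ∣u∣≡1+m : ∣ u ∣ ≡ suc m
  ∣u∣≡1+m = trans (x∉p⇒∣p∪⁅x⁆∣≡1+∣p∣ a∉D) (cong suc ∣D∣≡m)

  ∣u'∣≡1+m : ∣ u' ∣ ≡ suc m
  ∣u'∣≡1+m = trans (x∉p⇒∣p∪⁅x⁆∣≡1+∣p∣ b∉D) (cong suc ∣D∣≡m)

  private
    b∉u : b ∉ u
    b∉u b∈u = [ b∉D , (λ b∈⁅a⁆ → a≢b (sym (x∈⁅y⁆⇒x≡y a b∈⁅a⁆))) ] (x∈p∪q⁻ D ⁅ a ⁆ b∈u)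

    a∉u' : a ∉ u'
    a∉u' a∈u' = [ a∉D , a≢b ∘ x∈⁅y⁆⇒x≡y b ] (x∈p∪q⁻ D ⁅ b ⁆ a∈u')

  ∣z∣≡2+m : ∣ z ∣ ≡ suc (suc m)
  ∣z∣≡2+m = trans (x∉p⇒∣p∪⁅x⁆∣≡1+∣p∣ b∉u) (cong suc ∣u∣≡1+m)

  u⊆z : u ⊆ z
  u⊆z = p⊆p∪q ⁅ b ⁆

  u'⊆z : u' ⊆ z
  u'⊆z = ∪-least (u⊆z ∘ p⊆p∪q ⁅ a ⁆) (q⊆p∪q u ⁅ b ⁆)

  u≢u' : u ≢ u'
  u≢u' u≡u' = a∉u' (subst (a ∈_) u≡u' (q⊆p∪q D ⁅ a ⁆ (x∈⁅x⁆ a)))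

  u∩u'≡D : u ∩ u' ≡ D
  u∩u'≡D = ⊆-antisym u∩u'⊆D (∩-greatest (p⊆p∪q ⁅ a ⁆) (p⊆p∪q ⁅ b ⁆))
    where
    u∩u'⊆D : u ∩ u' ⊆ D
    u∩u'⊆D {x} x∈u∩u' with x∈p∪q⁻ D ⁅ a ⁆ (p∩q⊆p u u' x∈u∩u') | x∈p∪q⁻ D ⁅ b ⁆ (p∩q⊆q u u' x∈u∩u')
    ... | inj₁ x∈D | _ = x∈D
    ... | inj₂ _ | inj₁ x∈D = x∈D
    ... | inj₂ x∈⁅a⁆ | inj₂ x∈⁅b⁆ = ⊥-elim (a≢b (trans (sym (x∈⁅y⁆⇒x≡y a x∈⁅a⁆)) (x∈⁅y⁆⇒x≡y b x∈⁅b⁆)))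

module Descent {m : ℕ} (3+m≤n : suc (suc (suc m)) ≤ n)
  {α : Choose n (suc m) → Choose n (suc m)} {β : Choose n (suc (suc m)) → Choose n (suc (suc m))}
  (α⊆β : PreservesInclusion α β) (α-onto : StrictlySurjective _≡_ α) (β-onto : StrictlySurjective _≡_ β) where

  2+m≤n : suc (suc m) ≤ n
  2+m≤n = ≤-trans (n≤1+n _) 3+m≤n

  α-injective : Injective _≡_ _≡_ α
  α-injective = preservesInclusion⇒injective {β = β} α⊆β 3+m≤n

  cover-image : ∀ w x → CommonCover m (proj₁ w) (proj₁ x) → CommonCover m (proj₁ (α w)) (proj₁ (α x))
  cover-image w x (Z , w⊆Z , x⊆Z) = β Z , proj₁ (α⊆β w Z) w⊆Z , proj₁ (α⊆β x Z) x⊆Z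

  cover-preimage : ∀ w x → CommonCover m (proj₁ (α w)) (proj₁ (α x)) → CommonCover m (proj₁ w) (proj₁ x)
  cover-preimage w x (Z , αw⊆Z , αx⊆Z) with β-onto Z
  ... | Z' , refl = Z' , proj₂ (α⊆β w Z') αw⊆Z , proj₂ (α⊆β x Z') αx⊆Z

  module Image (D : Choose n m) where
    open Fork (proj₁ D) (proj₂ D) 2+m≤n public

    uᶜ u'ᶜ : Choose n (suc m)
    uᶜ = u , ∣u∣≡1+m
    u'ᶜ = u' , ∣u'∣≡1+m
    zᶜ : Choose n (suc (suc m))
    zᶜ = z , ∣z∣≡2+m

    αu≢αu' : proj₁ (α uᶜ) ≢ proj₁ (α u'ᶜ)
    αu≢αu' e = u≢u' (cong proj₁ (α-injective (Choose-≡ e)))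

    module Below = Siblings ∣z∣≡2+m ∣u∣≡1+m ∣u'∣≡1+m u⊆z u'⊆z u≢u'
    module Above = Siblings (proj₂ (β zᶜ)) (proj₂ (α uᶜ)) (proj₂ (α u'ᶜ))
                            (proj₁ (α⊆β uᶜ zᶜ) u⊆z) (proj₁ (α⊆β u'ᶜ zᶜ) u'⊆z) αu≢αu'

  γ : Choose n m → Choose n m
  γ D = proj₁ (α uᶜ) ∩ proj₁ (α u'ᶜ) , Above.∣u∩u'∣≡m
    where open Image D

  γ⊆α : PreservesInclusion γ α
  γ⊆α D w = to , from
    where
    open Image D
    to : proj₁ D ⊆ proj₁ w → proj₁ (γ D) ⊆ proj₁ (α w)
    to D⊆w with Below.u∩u'⊆⇒ (proj₂ w) (subst (_⊆ proj₁ w) (sym u∩u'≡D) D⊆w)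
    ... | inj₁ w≡u = subst (λ t → proj₁ (γ D) ⊆ proj₁ (α t)) (sym (Choose-≡ w≡u)) (p∩q⊆p _ _)
    ... | inj₂ (inj₁ w≡u') = subst (λ t → proj₁ (γ D) ⊆ proj₁ (α t)) (sym (Choose-≡ w≡u')) (p∩q⊆q _ _)
    ... | inj₂ (inj₂ (c , c' , w⊈z)) = Above.Outer⇒u∩u'⊆ (proj₂ (α w))
          (cover-image w uᶜ c , cover-image w u'ᶜ c' , w⊈z ∘ proj₂ (α⊆β w zᶜ))
    from : proj₁ (γ D) ⊆ proj₁ (α w) → proj₁ D ⊆ proj₁ w
    from γD⊆αw with Above.u∩u'⊆⇒ (proj₂ (α w)) γD⊆αw
    ... | inj₁ αw≡αu = subst (λ t → proj₁ D ⊆ proj₁ t) (sym (α-injective (Choose-≡ αw≡αu))) (p⊆p∪q _)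
    ... | inj₂ (inj₁ αw≡αu') = subst (λ t → proj₁ D ⊆ proj₁ t) (sym (α-injective (Choose-≡ αw≡αu'))) (p⊆p∪q _)
    ... | inj₂ (inj₂ (c , c' , αw⊈βz)) = subst (_⊆ proj₁ w) u∩u'≡D (Below.Outer⇒u∩u'⊆ (proj₂ w)
          (cover-preimage w uᶜ c , cover-preimage w u'ᶜ c' , αw⊈βz ∘ proj₁ (α⊆β w zᶜ)))

  γ-onto : StrictlySurjective _≡_ γ
  γ-onto E = D , Choose-≡ (⊆∧∣≡∣⇒≡ γD⊆E (trans (proj₂ (γ D)) (sym (proj₂ E))))
    where
    open Image E
    x y : Choose n (suc m)
    x = proj₁ (α-onto uᶜ)
    y = proj₁ (α-onto u'ᶜ)
    Z : Choose n (suc (suc m))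
    Z = proj₁ (β-onto zᶜ)
    x⊆Z : proj₁ x ⊆ proj₁ Z
    x⊆Z = proj₂ (α⊆β x Z)
      (subst₂ (λ s t → proj₁ s ⊆ proj₁ t) (sym (proj₂ (α-onto uᶜ))) (sym (proj₂ (β-onto zᶜ))) u⊆z)
    y⊆Z : proj₁ y ⊆ proj₁ Z
    y⊆Z = proj₂ (α⊆β y Z)
      (subst₂ (λ s t → proj₁ s ⊆ proj₁ t) (sym (proj₂ (α-onto u'ᶜ))) (sym (proj₂ (β-onto zᶜ))) u'⊆z)
    x≢y : proj₁ x ≢ proj₁ y
    x≢y x≡y = u≢u' (cong proj₁ (trans (sym (proj₂ (α-onto uᶜ))) (trans (cong α (Choose-≡ x≡y)) (proj₂ (α-onto u'ᶜ)))))
    D : Choose n m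
    D = proj₁ x ∩ proj₁ y , Siblings.∣u∩u'∣≡m (proj₂ Z) (proj₂ x) (proj₂ y) x⊆Z y⊆Z x≢y
    γD⊆E : proj₁ (γ D) ⊆ proj₁ E
    γD⊆E i∈γD = subst (_ ∈_) u∩u'≡D (x∈p∩q⁺
      ( subst (λ t → _ ∈ proj₁ t) (proj₂ (α-onto uᶜ)) (proj₁ (γ⊆α D x) (p∩q⊆p _ _) i∈γD)
      , subst (λ t → _ ∈ proj₁ t) (proj₂ (α-onto u'ᶜ)) (proj₁ (γ⊆α D y) (p∩q⊆q _ _) i∈γD)))

induced-lift : {α : Choose n (suc m) → Choose n (suc m)} {β : Choose n (suc (suc m)) → Choose n (suc (suc m))}
               {p : Fin n → Fin n} → PreservesInclusion α β → StrictlySurjective _≡_ α → InducedBy p α → InducedBy p β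
induced-lift {n} {m} {α} {β} {p} α⊆β α-onto p↝α v i = to , from
  where
  facet-through : (x : Fin n) {s : Subset n} → ∣ s ∣ ≡ suc (suc m) → x ∈ s → ∃ λ w → x ∈ proj₁ w × proj₁ w ⊆ s
  facet-through x ∣s∣≡2+m x∈s with between ⁅ x ⁆ _ (x∈p⇒⁅x⁆⊆p x∈s) (subst (_≤ suc m) (sym (∣⁅x⁆∣≡1 x)) (s≤s z≤n))
                                      (subst (suc m ≤_) (sym ∣s∣≡2+m) (n≤1+n _))
  ... | w , ⁅x⁆⊆w , w⊆s , ∣w∣≡1+m = (w , ∣w∣≡1+m) , ⁅x⁆⊆w (x∈⁅x⁆ x) , w⊆s
  to : i ∈ proj₁ v → p i ∈ proj₁ (β v)
  to i∈v with facet-through i (proj₂ v) i∈v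
  ... | w , i∈w , w⊆v = proj₁ (α⊆β w v) w⊆v (proj₁ (p↝α w i) i∈w)
  from : p i ∈ proj₁ (β v) → i ∈ proj₁ v
  from pi∈βv with facet-through (p i) (proj₂ (β v)) pi∈βv
  ... | W , pi∈W , W⊆βv with α-onto W
  ...   | w , refl = proj₂ (α⊆β w v) W⊆βv (proj₂ (p↝α w i) pi∈W)

induced-on-singletons : {β : Choose n 1 → Choose n 1} → Injective _≡_ _≡_ β → ∃ λ p → InducedBy p β
induced-on-singletons {n} {β} β-injective = p , λ v i → to v i , from v i
  where
  single : Fin n → Choose n 1
  single i = ⁅ i ⁆ , ∣⁅x⁆∣≡1 i
  image : ∀ i → Nonempty (proj₁ (β (single i)))
  image i = 0<∣p∣⇒Nonempty _ (subst (0 <_) (sym (proj₂ (β (single i)))) (s≤s z≤n))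
  p : Fin n → Fin n
  p i = proj₁ (image i)
  v≡single : ∀ v {i} → i ∈ proj₁ v → v ≡ single i
  v≡single v i∈v = Choose-≡ (∣p∣≡1∧x∈p⇒p≡⁅x⁆ (proj₂ v) i∈v)
  to : ∀ v i → i ∈ proj₁ v → p i ∈ proj₁ (β v)
  to v i i∈v = subst (λ t → p i ∈ proj₁ (β t)) (sym (v≡single v i∈v)) (proj₂ (image i))
  from : ∀ v i → p i ∈ proj₁ (β v) → i ∈ proj₁ v
  from v i pi∈βv = subst (λ t → i ∈ proj₁ t) (sym (β-injective (trans (v≡single (β v) pi∈βv)
                     (sym (v≡single (β (single i)) (proj₂ (image i))))))) (x∈⁅x⁆ i)

inclusion-preserving⇒induced : ∀ m → suc (suc m) ≤ n →
  {α : Choose n m → Choose n m} {β : Choose n (suc m) → Choose n (suc m)} →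
  PreservesInclusion α β → StrictlySurjective _≡_ α → StrictlySurjective _≡_ β → Injective _≡_ _≡_ β →
  ∃ λ p → InducedBy p β
inclusion-preserving⇒induced zero _ _ _ _ β-injective = induced-on-singletons β-injective
inclusion-preserving⇒induced (suc m) 3+m≤n {α} {β} α⊆β α-onto β-onto _ =
  map₂ (induced-lift {β = β} α⊆β α-onto) (inclusion-preserving⇒induced m 2+m≤n {γ} {α} γ⊆α γ-onto α-onto α-injective)
  where open Descent 3+m≤n α⊆β α-onto β-onto

induced-injective : {p : Fin (suc n) → Fin (suc n)} {β : Choose (suc n) m → Choose (suc n) m} →
                    1 ≤ m → m ≤ n → InducedBy p β → Injective _≡_ _≡_ p
induced-injective {β = β} 1≤m m≤n p↝β {i} {j} pi≡pj with i Fin.≟ j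
... | yes i≡j = i≡j
... | no i≢j with set-through-avoiding i≢j 1≤m m≤n
...   | v , i∈v , j∉v = contradiction (proj₂ (p↝β v j) (subst (_∈ proj₁ (β v)) pi≡pj (proj₁ (p↝β v i) i∈v))) j∉v

-- Rigid families of k-sets

Rigid : ℕ → (n : ℕ) → (Subset n → Bool) → Set
Rigid m n F = ∀ {p : Fin n → Fin n} {β : Choose n m → Choose n m} → InducedBy p β → StrictlySurjective _≡_ β →
              (∀ v → F (proj₁ (β v)) ≡ F (proj₁ v)) → ∀ i → p i ≡ i

bit : Bool → ℕ
bit true = 1
bit false = 0

∣b∷s∣≡bit+∣s∣ : ∀ b (s : Subset n) → ∣ b ∷ s ∣ ≡ bit b + ∣ s ∣
∣b∷s∣≡bit+∣s∣ true s = refl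
∣b∷s∣≡bit+∣s∣ false s = refl

_∷ᶜ_ : {t : ℕ} (b : Bool) → Choose n t → Choose (suc n) (bit b + t)
b ∷ᶜ (s , ∣s∣≡t) = b ∷ s , trans (∣b∷s∣≡bit+∣s∣ b s) (cong (bit b +_) ∣s∣≡t)

≡∷⇒≡∷tail : ∀ {b} {X : Subset (suc n)} {s : Subset n} → X ≡ b ∷ s → X ≡ b ∷ tail X
≡∷⇒≡∷tail refl = refl

∷-head-≡ : ∀ {b} (X : Subset (suc n)) {s : Subset n} →
          (zero ∈ X → zero ∈ b ∷ s) → (zero ∈ b ∷ s → zero ∈ X) → X ≡ b ∷ tail X
∷-head-≡ {b = true} (true ∷ X) _ _ = refl
∷-head-≡ {b = false} (false ∷ X) _ _ = refl
∷-head-≡ {b = true} (false ∷ X) _ from with from here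
... | ()
∷-head-≡ {b = false} (true ∷ X) to _ with to here
... | ()

module FixedHead {n t : ℕ} (b : Bool) {p : Fin (suc n) → Fin (suc n)}
  {β : Choose (suc n) (bit b + t) → Choose (suc n) (bit b + t)}
  (p↝β : InducedBy p β) (β-onto : StrictlySurjective _≡_ β) (p0≡0 : p zero ≡ zero)
  (1≤size : 1 ≤ bit b + t) (size≤n : bit b + t ≤ n) where

  0≢p∘suc : ∀ i → zero ≢ p (suc i)
  0≢p∘suc i 0≡psi = Finₚ.0≢1+n (induced-injective {β = β} 1≤size size≤n p↝β (trans p0≡0 0≡psi))

  p' : Fin n → Fin n
  p' i = Fin.punchOut (0≢p∘suc i)

  p∘suc≡suc∘p' : ∀ i → p (suc i) ≡ suc (p' i)
  p∘suc≡suc∘p' i = sym (Finₚ.punchIn-punchOut (0≢p∘suc i))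

  headed : Choose n t → Choose (suc n) (bit b + t)
  headed = b ∷ᶜ_

  tail-of : (X : Choose (suc n) (bit b + t)) → proj₁ X ≡ b ∷ tail (proj₁ X) → Choose n t
  tail-of (X , ∣X∣≡size) X≡b∷ = tail X , +-cancelˡ-≡ (bit b) _ _
    (trans (sym (∣b∷s∣≡bit+∣s∣ b (tail X))) (trans (cong ∣_∣ (sym X≡b∷)) ∣X∣≡size))

  headed-tail-of : ∀ X X≡b∷ → headed (tail-of X X≡b∷) ≡ X
  headed-tail-of X X≡b∷ = Choose-≡ (sym X≡b∷)

  head-preserved : ∀ v → proj₁ v ≡ b ∷ tail (proj₁ v) → proj₁ (β v) ≡ b ∷ tail (proj₁ (β v))
  head-preserved v v≡b∷ = ∷-head-≡ (proj₁ (β v))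
    (λ 0∈βv → subst (zero ∈_) v≡b∷ (proj₂ (p↝β v zero) (subst (_∈ proj₁ (β v)) (sym p0≡0) 0∈βv)))
    (λ 0∈b∷ → subst (_∈ proj₁ (β v)) p0≡0 (proj₁ (p↝β v zero) (subst (zero ∈_) (sym v≡b∷) 0∈b∷)))

  head-reflected : ∀ v → proj₁ (β v) ≡ b ∷ tail (proj₁ (β v)) → proj₁ v ≡ b ∷ tail (proj₁ v)
  head-reflected v βv≡b∷ = ∷-head-≡ (proj₁ v)
    (λ 0∈v → subst (zero ∈_) βv≡b∷ (subst (_∈ proj₁ (β v)) p0≡0 (proj₁ (p↝β v zero) 0∈v)))
    (λ 0∈b∷ → proj₂ (p↝β v zero) (subst (_∈ proj₁ (β v)) (sym p0≡0) (subst (zero ∈_) (sym βv≡b∷) 0∈b∷)))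

  β' : Choose n t → Choose n t
  β' w = tail-of (β (headed w)) (head-preserved (headed w) refl)

  β∘headed : ∀ w → β (headed w) ≡ headed (β' w)
  β∘headed w = sym (headed-tail-of _ _)

  p'↝β' : InducedBy p' β'
  p'↝β' w i = to , from
    where
    to : i ∈ proj₁ w → p' i ∈ proj₁ (β' w)
    to i∈w = drop-there (subst (λ X → suc (p' i) ∈ proj₁ X) (β∘headed w)
               (subst (_∈ proj₁ (β (headed w))) (p∘suc≡suc∘p' i) (proj₁ (p↝β (headed w) (suc i)) (there i∈w))))
    from : p' i ∈ proj₁ (β' w) → i ∈ proj₁ w
    from p'i∈β'w = drop-there (proj₂ (p↝β (headed w) (suc i))
               (subst (_∈ proj₁ (β (headed w))) (sym (p∘suc≡suc∘p' i))
                      (subst (λ X → suc (p' i) ∈ proj₁ X) (sym (β∘headed w)) (there p'i∈β'w))))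

  β'-onto : StrictlySurjective _≡_ β'
  β'-onto w with β-onto (headed w)
  ... | v , βv≡w = v' , Choose-≡ (cong (tail ∘ proj₁) (trans (cong β (headed-tail-of v v≡b∷)) βv≡w))
    where
    v≡b∷ : proj₁ v ≡ b ∷ tail (proj₁ v)
    v≡b∷ = head-reflected v (≡∷⇒≡∷tail (cong proj₁ βv≡w))
    v' : Choose n t
    v' = tail-of v v≡b∷

  fixes-all : {F : Subset (suc n) → Bool} {G : Subset n → Bool} → Rigid t n G →
              (∀ s s' → F (b ∷ s) ≡ F (b ∷ s') → G s ≡ G s') → (∀ v → F (proj₁ (β v)) ≡ F (proj₁ v)) →
              ∀ i → p i ≡ i
  fixes-all _ _ _ zero = p0≡0
  fixes-all {F} {G} G-rigid F⇒G F-preserved (suc i) =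
    trans (p∘suc≡suc∘p' i) (cong suc (G-rigid p'↝β' β'-onto G-preserved i))
    where
    G-preserved : ∀ w → G (proj₁ (β' w)) ≡ G (proj₁ w)
    G-preserved w = F⇒G (proj₁ (β' w)) (proj₁ w)
      (trans (cong (F ∘ proj₁) (sym (β∘headed w))) (F-preserved (headed w)))

Through Avoiding : ℕ → (Subset n → Bool) → Bool → Set
Through {n} m F b = ∀ y → ∃ λ (s : Choose n m) → y ∈ proj₁ s × F (proj₁ s) ≡ b
Avoiding {n} m F b = ∀ y → ∃ λ (s : Choose n m) → y ∉ proj₁ s × F (proj₁ s) ≡ b

record Good (m n : ℕ) (F : Subset n → Bool) : Set where
  field
    rigid : Rigid m n F
    unmarked-through : Through m F false
    unmarked-avoiding : Avoiding m F false
    some-marked : ∃ λ (s : Choose n m) → F (proj₁ s) ≡ true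

extend : (Subset n → Bool) → Subset (suc n) → Bool
extend F (x ∷ s) = not x ∧ not (F s)

cone : (Subset n → Bool) → Subset (suc n) → Bool
cone F (x ∷ s) = x ∧ F s

extend-∋0 : {F : Subset n → Bool} {s : Subset (suc n)} → zero ∈ s → extend F s ≡ false
extend-∋0 {s = true ∷ s} here = refl

cone-marked⇒∋0 : {F : Subset n → Bool} {s : Subset (suc n)} → cone F s ≡ true → zero ∈ s
cone-marked⇒∋0 {s = true ∷ s} _ = here

module _ {k n : ℕ} {F : Subset n → Bool} (good : Good (suc (suc k)) n F) (2+k<n : suc (suc k) < n) where
  open Good good

  private
    2+k≤n : suc (suc k) ≤ n
    2+k≤n = <⇒≤ 2+k<n
    1+k≤n : suc k ≤ n
    1+k≤n = ≤-trans (n≤1+n _) 2+k≤n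
    y₀ : Fin n
    y₀ = Fin.fromℕ< (≤-trans (s≤s z≤n) 2+k<n)

  extend-rigid : Rigid (suc (suc k)) (suc n) (extend F)
  extend-rigid {p} {β} p↝β β-onto preserved =
    FixedHead.fixes-all false p↝β β-onto p0≡0 (s≤s z≤n) 2+k≤n rigid (λ _ _ → not-injective) preserved
    where
    p0≢suc : ∀ y → p zero ≢ suc y
    p0≢suc y p0≡sy with unmarked-through y
    ... | S , y∈S , FS≡false with β-onto (false ∷ᶜ S)
    ...   | v , βv≡0S = contradiction (begin
            false                       ≡⟨ extend-∋0 0∈v ⟨
            extend F (proj₁ v)          ≡⟨ preserved v ⟨
            extend F (proj₁ (β v))      ≡⟨ cong (extend F ∘ proj₁) βv≡0S ⟩
            not (F (proj₁ S))           ≡⟨ cong not FS≡false ⟩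
            true                        ∎) λ ()
      where
      open ≡-Reasoning
      0∈v : zero ∈ proj₁ v
      0∈v = proj₂ (p↝β v zero)
        (subst (_∈ proj₁ (β v)) (sym p0≡sy) (subst (λ X → suc y ∈ proj₁ X) (sym βv≡0S) (there y∈S)))
    p0≡0 : p zero ≡ zero
    p0≡0 with p zero in p0≡
    ... | zero = refl
    ... | suc y = contradiction p0≡ (p0≢suc y)

  extend-unmarked-through : Through (suc (suc k)) (extend F) false
  extend-unmarked-through zero = true ∷ᶜ some-set 1+k≤n , here , refl
  extend-unmarked-through (suc y) with set-through y (s≤s z≤n) 1+k≤n
  ... | S , y∈S = true ∷ᶜ S , there y∈S , refl

  extend-unmarked-avoiding : Avoiding (suc (suc k)) (extend F) false
  extend-unmarked-avoiding zero = false ∷ᶜ proj₁ some-marked , (λ ()) , cong not (proj₂ some-marked)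
  extend-unmarked-avoiding (suc y) with set-avoiding y 2+k≤n
  ... | S , y∉S = true ∷ᶜ S , y∉S ∘ drop-there , refl

  extend-marked-avoiding : Avoiding (suc (suc k)) (extend F) true
  extend-marked-avoiding zero with unmarked-through y₀
  ... | S , _ , FS≡false = false ∷ᶜ S , (λ ()) , cong not FS≡false
  extend-marked-avoiding (suc y) with unmarked-avoiding y
  ... | S , y∉S , FS≡false = false ∷ᶜ S , y∉S ∘ drop-there , cong not FS≡false

  extend-good : Good (suc (suc k)) (suc n) (extend F)
  extend-good = record
    { rigid = extend-rigid
    ; unmarked-through = extend-unmarked-through
    ; unmarked-avoiding = extend-unmarked-avoiding
    ; some-marked = proj₁ (extend-marked-avoiding zero) , proj₂ (proj₂ (extend-marked-avoiding zero))
    }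

module _ {m n : ℕ} {F : Subset n → Bool} (good : Good m n F) (marked-avoiding : Avoiding m F true)
         (2+m≤n : suc (suc m) ≤ n) where
  open Good good

  private
    1+m≤n : suc m ≤ n
    1+m≤n = ≤-trans (n≤1+n _) 2+m≤n
    y₀ : Fin n
    y₀ = Fin.fromℕ< (≤-trans (s≤s z≤n) 2+m≤n)

  cone-rigid : Rigid (suc m) (suc n) (cone F)
  cone-rigid {p} {β} p↝β β-onto preserved =
    FixedHead.fixes-all true p↝β β-onto p0≡0 (s≤s z≤n) 1+m≤n rigid (λ _ _ → id) preserved
    where
    p0≢suc : ∀ y → p zero ≢ suc y
    p0≢suc y p0≡sy with marked-avoiding y
    ... | S , y∉S , FS≡true with β-onto (true ∷ᶜ S)
    ...   | v , βv≡1S = y∉S (drop-there (subst (λ X → suc y ∈ proj₁ X) βv≡1S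
                          (subst (_∈ proj₁ (β v)) p0≡sy (proj₁ (p↝β v zero) 0∈v))))
      where
      0∈v : zero ∈ proj₁ v
      0∈v = cone-marked⇒∋0 (trans (sym (preserved v)) (trans (cong (cone F ∘ proj₁) βv≡1S) FS≡true))
    p0≡0 : p zero ≡ zero
    p0≡0 with p zero in p0≡
    ... | zero = refl
    ... | suc y = contradiction p0≡ (p0≢suc y)

  cone-unmarked-through : Through (suc m) (cone F) false
  cone-unmarked-through zero with unmarked-through y₀
  ... | S , _ , FS≡false = true ∷ᶜ S , here , FS≡false
  cone-unmarked-through (suc y) with set-through y (s≤s z≤n) 1+m≤n
  ... | S , y∈S = false ∷ᶜ S , there y∈S , refl

  cone-unmarked-avoiding : Avoiding (suc m) (cone F) false
  cone-unmarked-avoiding zero = false ∷ᶜ some-set 1+m≤n , (λ ()) , refl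
  cone-unmarked-avoiding (suc y) with set-avoiding y 2+m≤n
  ... | S , y∉S = false ∷ᶜ S , y∉S ∘ drop-there , refl

  cone-good : Good (suc m) (suc n) (cone F)
  cone-good = record
    { rigid = cone-rigid
    ; unmarked-through = cone-unmarked-through
    ; unmarked-avoiding = cone-unmarked-avoiding
    ; some-marked = true ∷ᶜ proj₁ some-marked , proj₂ some-marked
    }

-- OnlyIdentityExtends is ps: however the points of is are then assigned images, one at a time and
-- respecting adjacency with the points already assigned, the resulting map is the identity.
-- Deciding it is a backtracking search that certifies the graph has no non-trivial automorphism.
module Asymmetry {n : ℕ} (E : Fin n → Fin n → Bool) where

  OnlyIdentityExtends : List (Fin n) → List (Fin n × Fin n) → Set
  OnlyIdentityExtends [] ps = All (λ q → proj₁ q ≡ proj₂ q) ps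
  OnlyIdentityExtends (i ∷ is) ps =
    ∀ x → All (λ q → E (proj₂ q) x ≡ E (proj₁ q) i) ps → OnlyIdentityExtends is ((i , x) ∷ ps)

  onlyIdentityExtends? : ∀ is ps → Dec (OnlyIdentityExtends is ps)
  onlyIdentityExtends? [] ps = All.all? (λ q → proj₁ q Fin.≟ proj₂ q) ps
  onlyIdentityExtends? (i ∷ is) ps = Finₚ.all? λ x →
    All.all? (λ q → E (proj₂ q) x Bool.≟ E (proj₁ q) i) ps →-dec onlyIdentityExtends? is ((i , x) ∷ ps)

  module _ (f : Fin n → Fin n) (f-preserves : ∀ a b → E (f a) (f b) ≡ E a b) where

    graph-consistent : ∀ i {q} → proj₂ q ≡ f (proj₁ q) → E (proj₂ q) (f i) ≡ E (proj₁ q) i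
    graph-consistent i {j , _} refl = f-preserves j i

    onlyIdentityExtends⇒fixed : ∀ is ps → OnlyIdentityExtends is ps → All (λ q → proj₂ q ≡ f (proj₁ q)) ps →
                                All (λ i → f i ≡ i) is × All (λ q → proj₁ q ≡ proj₂ q) ps
    onlyIdentityExtends⇒fixed [] ps certificate _ = [] , certificate
    onlyIdentityExtends⇒fixed (i ∷ is) ps certificate ps⊆graph
      with onlyIdentityExtends⇒fixed is ((i , f i) ∷ ps) (certificate (f i) (All.map (graph-consistent i) ps⊆graph))
                                     (refl ∷ ps⊆graph)
    ... | fixed , i≡fi ∷ ps-fixed = sym i≡fi ∷ fixed , ps-fixed

    only-identity : OnlyIdentityExtends (allFin n) [] → ∀ i → f i ≡ i
    only-identity certificate i =
      All.lookup (proj₁ (onlyIdentityExtends⇒fixed (allFin n) [] certificate [])) (∈-allFin i)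

-- The path 0-1-2-3-4-5 with the chord 1-3.
sixGraph : Subset 6 → Bool
sixGraph (a ∷ b ∷ c ∷ d ∷ e ∷ f ∷ []) = (a ∧ b) ∨ (b ∧ c) ∨ (c ∧ d) ∨ (d ∧ e) ∨ (e ∧ f) ∨ (b ∧ d)

sixGraph-adjacent : Fin 6 → Fin 6 → Bool
sixGraph-adjacent a b = sixGraph (⁅ a ⁆ ∪ ⁅ b ⁆)

sixGraph-rigid : Rigid 2 6 sixGraph
sixGraph-rigid {p} {β} p↝β _ preserved = Asymmetry.only-identity sixGraph-adjacent p edge-preserved
                                           (from-yes (Asymmetry.onlyIdentityExtends? sixGraph-adjacent (allFin 6) []))
  where
  loopless : ∀ x → sixGraph-adjacent x x ≡ false
  loopless = from-yes (Finₚ.all? λ x → sixGraph-adjacent x x Bool.≟ false)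
  image-of-pair : ∀ {a b} (a≢b : a ≢ b) → ⁅ p a ⁆ ∪ ⁅ p b ⁆ ≡ proj₁ (β (pair a≢b))
  image-of-pair {a} {b} a≢b = ⊆∧∣≡∣⇒≡
    (∪-least (x∈p⇒⁅x⁆⊆p (proj₁ (p↝β (pair a≢b) a) (p⊆p∪q ⁅ b ⁆ (x∈⁅x⁆ a))))
             (x∈p⇒⁅x⁆⊆p (proj₁ (p↝β (pair a≢b) b) (q⊆p∪q ⁅ a ⁆ ⁅ b ⁆ (x∈⁅x⁆ b)))))
    (trans (proj₂ (pair (a≢b ∘ induced-injective {β = β} (s≤s z≤n) (s≤s (s≤s z≤n)) p↝β)))
           (sym (proj₂ (β (pair a≢b)))))
  edge-preserved : ∀ a b → sixGraph-adjacent (p a) (p b) ≡ sixGraph-adjacent a b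
  edge-preserved a b with a Fin.≟ b
  ... | yes refl = trans (loopless (p a)) (sym (loopless a))
  ... | no a≢b = trans (cong sixGraph (image-of-pair a≢b)) (preserved (pair a≢b))

choose? : ∀ m {P : Subset n → Set} → (∀ s → Dec (P s)) → Dec (∃ λ (s : Choose n m) → P (proj₁ s))
choose? m P? = map′ (λ (s , ∣s∣≡m , Ps) → (s , ∣s∣≡m) , Ps) (λ ((s , ∣s∣≡m) , Ps) → s , ∣s∣≡m , Ps)
                    (anySubset? λ s → ∣ s ∣ ℕ.≟ m ×-dec P? s)

sixGraph-good : Good 2 6 sixGraph
sixGraph-good = record
  { rigid = sixGraph-rigid
  ; unmarked-through = from-yes (Finₚ.all? λ y → choose? 2 λ s → y ∈? s ×-dec sixGraph s Bool.≟ false)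
  ; unmarked-avoiding = from-yes (Finₚ.all? λ y → choose? 2 λ s → ¬? (y ∈? s) ×-dec sixGraph s Bool.≟ false)
  ; some-marked = from-yes (choose? 2 λ s → sixGraph s Bool.≟ true)
  }

sixGraph-marked-avoiding : Avoiding 2 sixGraph true
sixGraph-marked-avoiding = from-yes (Finₚ.all? λ y → choose? 2 λ s → ¬? (y ∈? s) ×-dec sixGraph s Bool.≟ true)

n₀-step : ∀ j → n₀ (4 + j) ≡ suc (suc (n₀ (3 + j)))
n₀-step j = cong (_+ 1) (*-suc 2 (3 + j))

2+j<n₀ : ∀ j → 2 + j < n₀ (2 + j)
2+j<n₀ zero = s≤s (s≤s (s≤s z≤n))
2+j<n₀ (suc j) = ≤-<-trans (m≤m+n (3 + j) _) (m<m+n _ z<s)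

threshold-family : ∀ j → ∃ (Good (2 + j) (n₀ (2 + j)))
threshold-family zero = sixGraph , sixGraph-good
threshold-family (suc zero) =
  cone sixGraph , cone-good sixGraph-good sixGraph-marked-avoiding (s≤s (s≤s (s≤s (s≤s z≤n))))
threshold-family (suc (suc j)) with threshold-family (suc j)
... | F , good = subst (∃ ∘ Good (4 + j)) (sym (n₀-step j))
  (cone (extend F) , cone-good (extend-good good (2+j<n₀ (suc j))) (extend-marked-avoiding good (2+j<n₀ (suc j)))
                                (s≤s (2+j<n₀ (suc j))))

good-family : ∀ j d → ∃ (Good (2 + j) (d + n₀ (2 + j)))
good-family j zero = threshold-family j
good-family j (suc d) with good-family j d
... | F , good = extend F , extend-good good (≤-trans (2+j<n₀ j) (m≤n+m _ d))

rigid-family : ∀ j n → n₀ (2 + j) ≤ n → ∃ (Rigid (2 + j) n)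
rigid-family j n n₀≤n with good-family j (n ∸ n₀ (2 + j))
... | F , good = subst (∃ ∘ Rigid (2 + j)) (m∸n+n≡m n₀≤n) (F , Good.rigid good)

-- The distinguishing chromatic number of LG₁(k, n)

module UpperBound {m n : ℕ} (F : Subset n → Bool) (F-rigid : Rigid (suc m) n F) (2+m≤n : suc (suc m) ≤ n) where

  G : Graph
  G = LG1 (suc m) n

  colour : Colouring G 3
  colour (inj₁ _) = zero
  colour (inj₂ (s , _)) = suc (if F s then suc zero else zero)

  proper : Proper G colour
  proper (inj₁ _) (inj₂ _) _ ()
  proper (inj₂ _) (inj₁ _) _ ()

  colour-determines-F : ∀ {s t} → colour (inj₂ s) ≡ colour (inj₂ t) → F (proj₁ s) ≡ F (proj₁ t)
  colour-determines-F {s , _} {t , _} e with F s | F t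
  ... | true | true = refl
  ... | false | false = refl
  ... | true | false = contradiction e λ ()
  ... | false | true = contradiction e λ ()

  left : (x : V G) → colour x ≡ zero → Choose n m
  left (inj₁ u) _ = u

  left-≡ : ∀ x c → x ≡ inj₁ (left x c)
  left-≡ (inj₁ u) _ = refl

  right : (x : V G) → colour x ≢ zero → Choose n (suc m)
  right (inj₁ _) c≢0 = ⊥-elim (c≢0 refl)
  right (inj₂ v) _ = v

  right-≡ : ∀ x c → x ≡ inj₂ (right x c)
  right-≡ (inj₁ _) c≢0 = ⊥-elim (c≢0 refl)
  right-≡ (inj₂ v) _ = refl

  module _ (σ : Automorphism G) (fixes : PreservesClasses G colour σ) where
    open Inverse (perm σ)

    α : Choose n m → Choose n m
    α u = left (to (inj₁ u)) (fixes (inj₁ u))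

    β : Choose n (suc m) → Choose n (suc m)
    β v = right (to (inj₂ v)) λ c≡0 → Finₚ.0≢1+n (trans (sym c≡0) (fixes (inj₂ v)))

    to-inj₁ : ∀ u → to (inj₁ u) ≡ inj₁ (α u)
    to-inj₁ u = left-≡ _ _

    to-inj₂ : ∀ v → to (inj₂ v) ≡ inj₂ (β v)
    to-inj₂ v = right-≡ _ _

    α⊆β : PreservesInclusion α β
    α⊆β u v = subst₂ (LG1-Adj (suc m) n) (to-inj₁ u) (to-inj₂ v) ∘ proj₁ (preserve σ (inj₁ u) (inj₂ v))
            , proj₂ (preserve σ (inj₁ u) (inj₂ v)) ∘ subst₂ (LG1-Adj (suc m) n) (sym (to-inj₁ u)) (sym (to-inj₂ v))

    α-onto : StrictlySurjective _≡_ α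
    α-onto u' = left x x-left , inj₁-injective (begin
      inj₁ (α (left x x-left))   ≡⟨ to-inj₁ _ ⟨
      to (inj₁ (left x x-left))  ≡⟨ cong to (left-≡ x x-left) ⟨
      to x                       ≡⟨ strictlyInverseˡ (inj₁ u') ⟩
      inj₁ u'                    ∎)
      where
      open ≡-Reasoning
      x : V G
      x = from (inj₁ u')
      x-left : colour x ≡ zero
      x-left = trans (sym (fixes x)) (cong colour (strictlyInverseˡ (inj₁ u')))

    β-onto : StrictlySurjective _≡_ β
    β-onto v' = right x x-right , inj₂-injective (begin
      inj₂ (β (right x x-right))   ≡⟨ to-inj₂ _ ⟨
      to (inj₂ (right x x-right))  ≡⟨ cong to (right-≡ x x-right) ⟨
      to x                         ≡⟨ strictlyInverseˡ (inj₂ v') ⟩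
      inj₂ v'                      ∎)
      where
      open ≡-Reasoning
      x : V G
      x = from (inj₂ v')
      x-right : colour x ≢ zero
      x-right c≡0 = Finₚ.0≢1+n (trans (sym c≡0) (trans (sym (fixes x)) (cong colour (strictlyInverseˡ (inj₂ v')))))

    β-injective : Injective _≡_ _≡_ β
    β-injective {v} {v'} βv≡βv' = inj₂-injective (begin
      inj₂ v              ≡⟨ strictlyInverseʳ (inj₂ v) ⟨
      from (to (inj₂ v))  ≡⟨ cong from (trans (to-inj₂ v) (trans (cong inj₂ βv≡βv') (sym (to-inj₂ v')))) ⟩
      from (to (inj₂ v')) ≡⟨ strictlyInverseʳ (inj₂ v') ⟩
      inj₂ v'             ∎)
      where open ≡-Reasoning

    F-preserved : ∀ v → F (proj₁ (β v)) ≡ F (proj₁ v)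
    F-preserved v = colour-determines-F {β v} {v} (trans (cong colour (sym (to-inj₂ v))) (fixes (inj₂ v)))

    β≗id : ∀ v → β v ≡ v
    β≗id with inclusion-preserving⇒induced m 2+m≤n {α} {β} α⊆β α-onto β-onto β-injective
    ... | p , p↝β = identity-induces-identity (F-rigid p↝β β-onto F-preserved) p↝β

    fixes-everything : ∀ x → to x ≡ x
    fixes-everything (inj₁ u) =
      trans (to-inj₁ u) (cong inj₁ (preservesInclusion-identity {α = α} {β = β} α⊆β 2+m≤n β≗id u))
    fixes-everything (inj₂ v) = trans (to-inj₂ v) (cong inj₂ (β≗id v))

  distinguishing : Distinguishing G colour
  distinguishing = fixes-everything

  has-distinguishing-colouring : HasDistColouring G 3
  has-distinguishing-colouring = colour , proper , distinguishing

swap : Subset (suc (suc n)) → Subset (suc (suc n))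
swap (a ∷ b ∷ s) = b ∷ a ∷ s

swap-involutive : (s : Subset (suc (suc n))) → swap (swap s) ≡ s
swap-involutive (a ∷ b ∷ s) = refl

∣swap∣ : (s : Subset (suc (suc n))) → ∣ swap s ∣ ≡ ∣ s ∣
∣swap∣ (true ∷ true ∷ s) = refl
∣swap∣ (true ∷ false ∷ s) = refl
∣swap∣ (false ∷ true ∷ s) = refl
∣swap∣ (false ∷ false ∷ s) = refl

swap-⊆ : (x y : Subset (suc (suc n))) → x ⊆ y → swap x ⊆ swap y
swap-⊆ (_ ∷ _ ∷ x) (_ ∷ _ ∷ y) x⊆y {zero} here with x⊆y (there here)
... | there here = here
swap-⊆ (_ ∷ _ ∷ x) (_ ∷ _ ∷ y) x⊆y {suc zero} (there here) with x⊆y here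
... | here = there here
swap-⊆ (_ ∷ _ ∷ x) (_ ∷ _ ∷ y) x⊆y {suc (suc i)} (there (there i∈x)) =
  there (there (drop-there (drop-there (x⊆y (there (there i∈x))))))

swap-⊆⁻ : (x y : Subset (suc (suc n))) → swap x ⊆ swap y → x ⊆ y
swap-⊆⁻ x y sx⊆sy = subst₂ _⊆_ (swap-involutive x) (swap-involutive y) (swap-⊆ (swap x) (swap y) sx⊆sy)

two-colours : ∀ {c} → c < 3 → {a b d : Fin c} → a ≢ d → b ≢ d → a ≡ b
two-colours {suc zero} _ {zero} {zero} _ _ = refl
two-colours {suc (suc zero)} _ {zero} {zero} _ _ = refl
two-colours {suc (suc zero)} _ {suc zero} {suc zero} _ _ = refl
two-colours {suc (suc zero)} _ {zero} {suc zero} {zero} a≢d _ = ⊥-elim (a≢d refl)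
two-colours {suc (suc zero)} _ {zero} {suc zero} {suc zero} _ b≢d = ⊥-elim (b≢d refl)
two-colours {suc (suc zero)} _ {suc zero} {zero} {zero} _ b≢d = ⊥-elim (b≢d refl)
two-colours {suc (suc zero)} _ {suc zero} {zero} {suc zero} a≢d _ = ⊥-elim (a≢d refl)
two-colours {suc (suc (suc _))} (s≤s (s≤s (s≤s ())))

module LowerBound {j n : ℕ} where

  G : Graph
  G = LG1 (suc (suc j)) (suc (suc n))

  τ : V G → V G
  τ (inj₁ (s , ∣s∣≡1+j)) = inj₁ (swap s , trans (∣swap∣ s) ∣s∣≡1+j)
  τ (inj₂ (s , ∣s∣≡2+j)) = inj₂ (swap s , trans (∣swap∣ s) ∣s∣≡2+j)

  τ-involutive : ∀ x → τ (τ x) ≡ x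
  τ-involutive (inj₁ (s , _)) = cong inj₁ (Choose-≡ (swap-involutive s))
  τ-involutive (inj₂ (s , _)) = cong inj₂ (Choose-≡ (swap-involutive s))

  τ-automorphism : Automorphism G
  τ-automorphism = record { perm = mk↔ₛ′ τ τ τ-involutive τ-involutive ; preserve = preserve′ }
    where
    preserve′ : ∀ x y → (Adj G x y → Adj G (τ x) (τ y)) × (Adj G (τ x) (τ y) → Adj G x y)
    preserve′ (inj₁ (u , _)) (inj₂ (v , _)) = swap-⊆ u v , swap-⊆⁻ u v
    preserve′ (inj₂ (v , _)) (inj₁ (u , _)) = swap-⊆ u v , swap-⊆⁻ u v
    preserve′ (inj₁ _) (inj₁ _) = (λ ()) , (λ ())
    preserve′ (inj₂ _) (inj₂ _) = (λ ()) , (λ ())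

  τ-preserves-classes : ∀ {c} → c < 3 → (col : Colouring G c) → Proper G col → PreservesClasses G col τ-automorphism
  τ-preserves-classes c<3 col proper = preserved
    where
    preserved : ∀ x → col (τ x) ≡ col x
    preserved (inj₁ (true ∷ true ∷ t , _)) = refl
    preserved (inj₁ (false ∷ false ∷ t , _)) = refl
    preserved x@(inj₁ (true ∷ false ∷ t , e)) =
      two-colours c<3 (proper (τ x) w (out⊆ (in⊆in ⊆-refl))) (proper x w (in⊆in (out⊆ ⊆-refl)))
      where
      w : V G
      w = inj₂ (true ∷ true ∷ t , cong suc e)
    preserved x@(inj₁ (false ∷ true ∷ t , e)) =
      two-colours c<3 (proper (τ x) w (in⊆in (out⊆ ⊆-refl))) (proper x w (out⊆ (in⊆in ⊆-refl)))
      where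
      w : V G
      w = inj₂ (true ∷ true ∷ t , cong suc e)
    preserved (inj₂ (true ∷ true ∷ t , _)) = refl
    preserved (inj₂ (false ∷ false ∷ t , _)) = refl
    preserved x@(inj₂ (true ∷ false ∷ t , e)) =
      two-colours c<3 (proper (τ x) w (out⊆ (out⊆ ⊆-refl))) (proper x w (out⊆ (out⊆ ⊆-refl)))
      where
      w : V G
      w = inj₁ (false ∷ false ∷ t , suc-injective e)
    preserved x@(inj₂ (false ∷ true ∷ t , e)) =
      two-colours c<3 (proper (τ x) w (out⊆ (out⊆ ⊆-refl))) (proper x w (out⊆ (out⊆ ⊆-refl)))
      where
      w : V G
      w = inj₁ (false ∷ false ∷ t , suc-injective e)

  no-distinguishing-colouring : j ≤ n → ∀ c → c < 3 → ¬ HasDistColouring G c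
  no-distinguishing-colouring j≤n c c<3 (col , proper , distinguishing) =
    contradiction (distinguishing τ-automorphism (τ-preserves-classes c<3 col proper) x₀) λ ()
    where
    x₀ : V G
    x₀ = inj₁ (true ∷ᶜ (false ∷ᶜ some-set j≤n))

mainTheorem4 : ∀ (k n : ℕ) → 2 ≤ k → n₀ k ≤ n → DistChromaticNumberIs (LG1 k n) 3
mainTheorem4 (suc (suc j)) n _ n₀≤n with ≤-trans (2+j<n₀ j) n₀≤n | rigid-family j n n₀≤n
... | 3+j≤n@(s≤s (s≤s (s≤s j≤n'))) | F , F-rigid =
  UpperBound.has-distinguishing-colouring F F-rigid 3+j≤n ,
  LowerBound.no-distinguishing-colouring (m≤n⇒m≤1+n j≤n')
mainTheorem4 (suc zero) _ (s≤s ()) _
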